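{- Let $A_n$ be the number of ways to tile an $n$-board using squares and $(1,1)$-fences, for $n\ge0$, and set $A_n=0$ for $n<0$. Then for all integers $n\ge0$, \[ A_n=\delta_{n,0}+A_{n-1}+A_{n-3}+A_{n-4}. \]
   Context: An $n$-board is a $1\times n$ row of $n$ unit cells. A square is a $1\times1$ tile. A $(1,1)$-fence is a tile consisting of two $1\times1$ posts separated by a one-cell gap; placed on a board its posts occupy cells $i$ and $i+2$, and the gap cell $i+1$ must be covered by another tile. A tiling covers every cell exactly once; the $0$-board has exactly one (empty) tiling, so $A_0=1$. $\delta_{i,j}$ is $1$ if $i=j$ and $0$ otherwise. -}

module Defs where

open import Data.Bool using (Bool; true; false; _∧_; _∨_; if_then_else_)
open import Data.Nat using (ℕ; zero; suc; _+_; _∸_; _≡ᵇ_)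
open import Data.Fin using (Fin; toℕ)
open import Data.Vec using (Vec; []; _∷_; lookup)
open import Data.List using (List; []; _∷_; _++_; map; concatMap; length; filterᵇ; allFin)
open import Data.Nat.ListAction using (sum)
open import Data.Bool.ListAction using (all)
open import Data.Product using (_×_; _,_)
open import Data.Integer using (ℤ; +_; -[1+_])

-- A placement of tiles on an n-board is a choice of
--   * a set of squares:  square at cell i (0 ≤ i < n), given as Vec Bool n
--   * a set of (1,1)-fences: fence with posts at cells i and i+2 (i+2 < n,
--     i.e. i < n ∸ 2), given as Vec Bool (n ∸ 2).
Placement : ℕ → Set
Placement n = Vec Bool n × Vec Bool (n ∸ 2)

allVecs : (m : ℕ) → List (Vec Bool m)
allVecs zero = [] ∷ []
allVecs (suc m) = map (true ∷_) (allVecs m) ++ map (false ∷_) (allVecs m)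

allPlacements : (n : ℕ) → List (Placement n)
allPlacements n = concatMap (λ s → map (λ f → s , f) (allVecs (n ∸ 2))) (allVecs n)

ind : Bool → ℕ
ind true = 1
ind false = 0

coverCount : {n : ℕ} → Placement n → Fin n → ℕ
coverCount {n} (s , f) j =
  sum (map (λ i → ind (lookup s i ∧ (toℕ i ≡ᵇ toℕ j))) (allFin n))
  + sum (map (λ i → ind (lookup f i ∧ ((toℕ i ≡ᵇ toℕ j) ∨ ((toℕ i + 2) ≡ᵇ toℕ j)))) (allFin (n ∸ 2)))

isTiling : {n : ℕ} → Placement n → Bool
isTiling {n} p = all (λ j → coverCount p j ≡ᵇ 1) (allFin n)

A : ℕ → ℕ
A n = length (filterᵇ isTiling (allPlacements n))

Aℤ : ℤ → ℕ
Aℤ (+ n) = A n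
Aℤ -[1+ n ] = 0

δ : ℕ → ℕ → ℕ
δ i j = if i ≡ᵇ j then 1 else 0

{-# OPTIONS --safe #-}
-- Cell 0 is covered either by a square, leaving an
-- (n−1)-board, or by the left post of a fence whose right post lands on cell 2.
-- In the second case cell 1 is covered by a square, leaving an (n−3)-board, or
-- by the left post of a second fence, whose right post lands on cell 3 right
-- after the first fence filled cell 2, leaving an (n−4)-board.  To run this
-- induction on the encoding of placements as Boolean vectors, the exact-cover
-- condition is generalised to boards whose first two cells already carry posts
-- of fences lying further left.
module Submission where

open import Defs
open import Data.Nat using (ℕ; zero; suc; _+_; _∸_; _≡ᵇ_)
open import Data.Integer using (+_; _-_)
open import Data.Nat.Properties using (+-identityʳ; +-suc; +-assoc; +-commutativeSemigroup)
open import Data.Nat.ListAction using (sum)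
open import Data.Nat.ListAction.Properties using (sum-++)
open import Data.Bool using (Bool; true; false; _∧_; _∨_)
open import Data.Bool.ListAction using (and)
open import Data.Bool.Properties using (∧-identityʳ; ∧-zeroʳ)
open import Data.Fin using (Fin; toℕ) renaming (zero to fzero; suc to fsuc)
open import Data.Vec using (Vec; []; _∷_; lookup)
open import Data.List using (List; []; _∷_; _++_; map; concatMap; length; filterᵇ; tabulate)
open import Data.List.Properties using (map-++; map-∘; map-cong; map-tabulate; tabulate-cong)
open import Data.Product using (_,_)
open import Function using (_∘_; id)
open import Algebra.Properties.CommutativeSemigroup +-commutativeSemigroup using (interchange)
open import Relation.Binary.PropositionalEquality using (_≡_; refl; sym; trans; cong; cong₂; module ≡-Reasoning)

open ≡-Reasoning

sum-map-++ : {X : Set} (g : X → ℕ) (xs ys : List X) →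
             sum (map g (xs ++ ys)) ≡ sum (map g xs) + sum (map g ys)
sum-map-++ g xs ys = trans (cong sum (map-++ g xs ys)) (sum-++ (map g xs) (map g ys))

sum-map-+ : {X : Set} (g h : X → ℕ) (xs : List X) →
            sum (map (λ x → g x + h x) xs) ≡ sum (map g xs) + sum (map h xs)
sum-map-+ g h [] = refl
sum-map-+ g h (x ∷ xs) =
  trans (cong (_+_ (g x + h x)) (sum-map-+ g h xs)) (interchange (g x) (h x) _ _)

sum-map-zero : {X : Set} {g : X → ℕ} → (∀ x → g x ≡ 0) → (xs : List X) → sum (map g xs) ≡ 0
sum-map-zero g≡0 [] = refl
sum-map-zero g≡0 (x ∷ xs) = cong₂ _+_ (g≡0 x) (sum-map-zero g≡0 xs)

sum-map-concatMap : {X Y : Set} (g : Y → ℕ) (h : X → List Y) (xs : List X) →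
                    sum (map g (concatMap h xs)) ≡ sum (map (λ x → sum (map g (h x))) xs)
sum-map-concatMap g h [] = refl
sum-map-concatMap g h (x ∷ xs) =
  trans (sum-map-++ g (h x) (concatMap h xs)) (cong (_+_ (sum (map g (h x)))) (sum-map-concatMap g h xs))

sum-tabulate-zero : ∀ {n} {k : Fin n → ℕ} → (∀ i → k i ≡ 0) → sum (tabulate k) ≡ 0
sum-tabulate-zero {zero} k≡0 = refl
sum-tabulate-zero {suc n} k≡0 = cong₂ _+_ (k≡0 fzero) (sum-tabulate-zero (k≡0 ∘ fsuc))

length-filterᵇ : {X : Set} (p : X → Bool) (xs : List X) → length (filterᵇ p xs) ≡ sum (map (ind ∘ p) xs)
length-filterᵇ p [] = refl
length-filterᵇ p (x ∷ xs) with p x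
... | true = cong suc (length-filterᵇ p xs)
... | false = length-filterᵇ p xs

squaresOn : ∀ {n} → Vec Bool n → ℕ → ℕ
squaresOn [] j = 0
squaresOn (x ∷ s) zero = ind x
squaresOn (x ∷ s) (suc j) = squaresOn s j

fencePostsOn : ∀ {m} → Vec Bool m → ℕ → ℕ
fencePostsOn [] j = 0
fencePostsOn (y ∷ f) zero = ind y
fencePostsOn (y ∷ f) (suc j) = ind (y ∧ (1 ≡ᵇ j)) + fencePostsOn f j

sum-squaresOn : ∀ {n} (s : Vec Bool n) (j : ℕ) →
                sum (tabulate (λ i → ind (lookup s i ∧ (toℕ i ≡ᵇ j)))) ≡ squaresOn s j
sum-squaresOn [] j = refl
sum-squaresOn (x ∷ s) zero =
  trans (cong₂ _+_ (cong ind (∧-identityʳ x)) (sum-tabulate-zero (cong ind ∘ ∧-zeroʳ ∘ lookup s)))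
        (+-identityʳ (ind x))
sum-squaresOn (x ∷ s) (suc j) = cong₂ _+_ (cong ind (∧-zeroʳ x)) (sum-squaresOn s j)

sum-fencePostsOn : ∀ {m} (f : Vec Bool m) (j : ℕ) →
                   sum (tabulate (λ i → ind (lookup f i ∧ ((toℕ i ≡ᵇ j) ∨ (toℕ i + 2 ≡ᵇ j)))))
                   ≡ fencePostsOn f j
sum-fencePostsOn [] j = refl
sum-fencePostsOn (y ∷ f) zero =
  trans (cong₂ _+_ (cong ind (∧-identityʳ y)) (sum-tabulate-zero (cong ind ∘ ∧-zeroʳ ∘ lookup f)))
        (+-identityʳ (ind y))
sum-fencePostsOn (y ∷ f) (suc j) = cong (_+_ (ind (y ∧ (1 ≡ᵇ j)))) (sum-fencePostsOn f j)

coverCount≡squaresOn+fencePostsOn : ∀ {n} (s : Vec Bool n) (f : Vec Bool (n ∸ 2)) (j : Fin n) →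
                                    coverCount (s , f) j ≡ squaresOn s (toℕ j) + fencePostsOn f (toℕ j)
coverCount≡squaresOn+fencePostsOn {n} s f j = cong₂ _+_
  (trans (cong sum (map-tabulate {n = n} id _)) (sum-squaresOn s (toℕ j)))
  (trans (cong sum (map-tabulate {n = n ∸ 2} id _)) (sum-fencePostsOn f (toℕ j)))

-- isTilingFrom a b s f: every cell is covered exactly once when cells 0 and 1
-- already carry a and b posts of fences placed further left.
isTilingFrom : ∀ {n} → ℕ → ℕ → Vec Bool n → Vec Bool (n ∸ 2) → Bool
isTilingFrom {0} a b [] [] = true
isTilingFrom {1} a b (x ∷ []) [] = a + ind x ≡ᵇ 1
isTilingFrom {2} a b (x ∷ x′ ∷ []) [] = (a + ind x ≡ᵇ 1) ∧ (b + ind x′ ≡ᵇ 1)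
isTilingFrom {suc (suc (suc _))} a b (x ∷ s) (y ∷ f) =
  (a + ind x + ind y ≡ᵇ 1) ∧ isTilingFrom b (ind y) s f

postsFrom : ℕ → ℕ → ℕ → ℕ
postsFrom a b 0 = a
postsFrom a b 1 = b
postsFrom a b (suc (suc _)) = 0

coverFrom : ∀ {n} → ℕ → ℕ → Vec Bool n → Vec Bool (n ∸ 2) → ℕ → ℕ
coverFrom a b s f j = postsFrom a b j + squaresOn s j + fencePostsOn f j

coverFrom-0-0 : ∀ {n} (s : Vec Bool n) (f : Vec Bool (n ∸ 2)) (j : ℕ) →
                coverFrom 0 0 s f j ≡ squaresOn s j + fencePostsOn f j
coverFrom-0-0 s f 0 = refl
coverFrom-0-0 s f 1 = refl
coverFrom-0-0 s f (suc (suc _)) = refl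

-- The right post of the fence y at cell 0 lands on cell 2, which is cell 1 of the remaining board.
coverFrom-∷ : ∀ {m} a b x y (s : Vec Bool (2 + m)) (f : Vec Bool m) (j : ℕ) →
              coverFrom a b (x ∷ s) (y ∷ f) (suc j) ≡ coverFrom b (ind y) s f j
coverFrom-∷ a b x true s f 0 = refl
coverFrom-∷ a b x false s f 0 = refl
coverFrom-∷ a b x true s f 1 = +-suc (squaresOn s 1) (fencePostsOn f 1)
coverFrom-∷ a b x false s f 1 = refl
coverFrom-∷ a b x true s f (suc (suc _)) = refl
coverFrom-∷ a b x false s f (suc (suc _)) = refl

all-coverFrom≡ᵇ1 : ∀ {n} a b (s : Vec Bool n) (f : Vec Bool (n ∸ 2)) →
                   and (tabulate (λ (j : Fin n) → coverFrom a b s f (toℕ j) ≡ᵇ 1)) ≡ isTilingFrom a b s f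
all-coverFrom≡ᵇ1 {0} a b [] [] = refl
all-coverFrom≡ᵇ1 {1} a b (x ∷ []) [] =
  trans (∧-identityʳ _) (cong (_≡ᵇ 1) (+-identityʳ (a + ind x)))
all-coverFrom≡ᵇ1 {2} a b (x ∷ x′ ∷ []) [] =
  cong₂ _∧_ (cong (_≡ᵇ 1) (+-identityʳ (a + ind x)))
            (trans (∧-identityʳ _) (cong (_≡ᵇ 1) (+-identityʳ (b + ind x′))))
all-coverFrom≡ᵇ1 {suc (suc (suc m))} a b (x ∷ s) (y ∷ f) =
  cong (_∧_ (a + ind x + ind y ≡ᵇ 1))
       (trans (cong and (tabulate-cong {n = 2 + m} (λ j → cong (_≡ᵇ 1) (coverFrom-∷ a b x y s f (toℕ j)))))
              (all-coverFrom≡ᵇ1 b (ind y) s f))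

isTiling≡isTilingFrom-0-0 : ∀ {n} (s : Vec Bool n) (f : Vec Bool (n ∸ 2)) →
                            isTiling (s , f) ≡ isTilingFrom 0 0 s f
isTiling≡isTilingFrom-0-0 {n} s f = begin
  isTiling (s , f)
    ≡⟨ cong and (map-tabulate {n = n} id _) ⟩
  and (tabulate (λ j → coverCount (s , f) j ≡ᵇ 1))
    ≡⟨ cong and (tabulate-cong (λ j → cong (_≡ᵇ 1) (trans (coverCount≡squaresOn+fencePostsOn s f j)
                                                         (sym (coverFrom-0-0 s f (toℕ j)))))) ⟩
  and (tabulate (λ (j : Fin n) → coverFrom 0 0 s f (toℕ j) ≡ᵇ 1))
    ≡⟨ all-coverFrom≡ᵇ1 0 0 s f ⟩
  isTilingFrom 0 0 s f ∎

sumBool : (Bool → ℕ) → ℕ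
sumBool h = h true + h false

sum-allVecs-suc : ∀ k (g : Vec Bool (suc k) → ℕ) →
                  sum (map g (allVecs (suc k))) ≡ sumBool (λ x → sum (map (g ∘ (x ∷_)) (allVecs k)))
sum-allVecs-suc k g = begin
  sum (map g (allVecs (suc k)))
    ≡⟨ sum-map-++ g (map (true ∷_) (allVecs k)) (map (false ∷_) (allVecs k)) ⟩
  sum (map g (map (true ∷_) (allVecs k))) + sum (map g (map (false ∷_) (allVecs k)))
    ≡⟨ sym (cong₂ _+_ (cong sum (map-∘ (allVecs k))) (cong sum (map-∘ (allVecs k)))) ⟩
  sumBool (λ x → sum (map (g ∘ (x ∷_)) (allVecs k))) ∎

sumPlacements : (n : ℕ) → (Vec Bool n → Vec Bool (n ∸ 2) → ℕ) → ℕ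
sumPlacements n g = sum (map (λ s → sum (map (g s) (allVecs (n ∸ 2)))) (allVecs n))

sumPlacements-zero : ∀ n → sumPlacements n (λ _ _ → 0) ≡ 0
sumPlacements-zero n = sum-map-zero (λ _ → sum-map-zero (λ _ → refl) (allVecs (n ∸ 2))) (allVecs n)

sumPlacements-∷ : ∀ m (g : Vec Bool (3 + m) → Vec Bool (1 + m) → ℕ) →
                  sumPlacements (3 + m) g
                  ≡ sumBool (λ x → sumBool (λ y → sumPlacements (2 + m) (λ s f → g (x ∷ s) (y ∷ f))))
sumPlacements-∷ m g = begin
  sumPlacements (3 + m) g
    ≡⟨ sum-allVecs-suc (2 + m) _ ⟩
  sumBool (λ x → sum (map (λ s → sum (map (g (x ∷ s)) (allVecs (1 + m)))) (allVecs (2 + m))))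
    ≡⟨ cong₂ _+_ (split-fences true) (split-fences false) ⟩
  sumBool (λ x → sumBool (λ y → sumPlacements (2 + m) (λ s f → g (x ∷ s) (y ∷ f)))) ∎
  where
  split-fences : ∀ x →
    sum (map (λ s → sum (map (g (x ∷ s)) (allVecs (1 + m)))) (allVecs (2 + m)))
    ≡ sumBool (λ y → sumPlacements (2 + m) (λ s f → g (x ∷ s) (y ∷ f)))
  split-fences x =
    trans (cong sum (map-cong (λ s → sum-allVecs-suc m (g (x ∷ s))) (allVecs (2 + m))))
          (sum-map-+ _ _ (allVecs (2 + m)))

tilingsFrom : ℕ → ℕ → ℕ → ℕ
tilingsFrom a b n = sumPlacements n (λ s f → ind (isTilingFrom a b s f))

A≡tilingsFrom-0-0 : ∀ n → A n ≡ tilingsFrom 0 0 n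
A≡tilingsFrom-0-0 n = begin
  A n
    ≡⟨ length-filterᵇ isTiling (allPlacements n) ⟩
  sum (map (ind ∘ isTiling) (allPlacements n))
    ≡⟨ sum-map-concatMap (ind ∘ isTiling) _ (allVecs n) ⟩
  sum (map (λ s → sum (map (ind ∘ isTiling) (map (s ,_) (allVecs (n ∸ 2))))) (allVecs n))
    ≡⟨ cong sum (map-cong (λ s → cong sum (sym (map-∘ (allVecs (n ∸ 2))))) (allVecs n)) ⟩
  sumPlacements n (λ s f → ind (isTiling (s , f)))
    ≡⟨ cong sum (map-cong (λ s → cong sum (map-cong (λ f → cong ind (isTiling≡isTilingFrom-0-0 s f))
                                                    (allVecs (n ∸ 2)))) (allVecs n)) ⟩
  tilingsFrom 0 0 n ∎

tilingsFrom-0-suc³ : ∀ b m → tilingsFrom 0 b (3 + m) ≡ tilingsFrom b 0 (2 + m) + tilingsFrom b 1 (2 + m)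
tilingsFrom-0-suc³ b m =
  trans (sumPlacements-∷ m _)
        (cong₂ _+_ (cong (_+ tilingsFrom b 0 (2 + m)) (sumPlacements-zero (2 + m)))
                   (trans (cong (_+_ (tilingsFrom b 1 (2 + m))) (sumPlacements-zero (2 + m)))
                          (+-identityʳ _)))

tilingsFrom-1-suc³ : ∀ b m → tilingsFrom 1 b (3 + m) ≡ tilingsFrom b 0 (2 + m)
tilingsFrom-1-suc³ b m =
  trans (sumPlacements-∷ m _)
        (cong₂ _+_ (cong₂ _+_ (sumPlacements-zero (2 + m)) (sumPlacements-zero (2 + m)))
                   (cong (_+ tilingsFrom b 0 (2 + m)) (sumPlacements-zero (2 + m))))

tilings-recurrence : ∀ i → tilingsFrom 0 0 (7 + i)
                           ≡ tilingsFrom 0 0 (6 + i) + tilingsFrom 0 0 (4 + i) + tilingsFrom 0 0 (3 + i)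
tilings-recurrence i = begin
  tilingsFrom 0 0 (7 + i)
    ≡⟨ tilingsFrom-0-suc³ 0 (4 + i) ⟩
  tilingsFrom 0 0 (6 + i) + tilingsFrom 0 1 (6 + i)
    ≡⟨ cong (_+_ (tilingsFrom 0 0 (6 + i))) fence-first ⟩
  tilingsFrom 0 0 (6 + i) + (tilingsFrom 0 0 (4 + i) + tilingsFrom 0 0 (3 + i))
    ≡⟨ sym (+-assoc (tilingsFrom 0 0 (6 + i)) _ _) ⟩
  tilingsFrom 0 0 (6 + i) + tilingsFrom 0 0 (4 + i) + tilingsFrom 0 0 (3 + i) ∎
  where
  fence-first : tilingsFrom 0 1 (6 + i) ≡ tilingsFrom 0 0 (4 + i) + tilingsFrom 0 0 (3 + i)
  fence-first = begin
    tilingsFrom 0 1 (6 + i)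
      ≡⟨ tilingsFrom-0-suc³ 1 (3 + i) ⟩
    tilingsFrom 1 0 (5 + i) + tilingsFrom 1 1 (5 + i)
      ≡⟨ cong₂ _+_ (tilingsFrom-1-suc³ 0 (2 + i))
                   (trans (tilingsFrom-1-suc³ 1 (2 + i)) (tilingsFrom-1-suc³ 0 (1 + i))) ⟩
    tilingsFrom 0 0 (4 + i) + tilingsFrom 0 0 (3 + i) ∎

theorem2p1 : (n : ℕ) → A n ≡ δ n 0 + Aℤ (+ n - + 1) + Aℤ (+ n - + 3) + Aℤ (+ n - + 4)
theorem2p1 0 = refl
theorem2p1 1 = refl
theorem2p1 2 = refl
theorem2p1 3 = refl
theorem2p1 4 = refl
theorem2p1 5 = refl
theorem2p1 6 = refl
theorem2p1 (suc (suc (suc (suc (suc (suc (suc i))))))) = begin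
  A (7 + i)
    ≡⟨ A≡tilingsFrom-0-0 (7 + i) ⟩
  tilingsFrom 0 0 (7 + i)
    ≡⟨ tilings-recurrence i ⟩
  tilingsFrom 0 0 (6 + i) + tilingsFrom 0 0 (4 + i) + tilingsFrom 0 0 (3 + i)
    ≡⟨ sym (cong₂ _+_ (cong₂ _+_ (A≡tilingsFrom-0-0 (6 + i)) (A≡tilingsFrom-0-0 (4 + i)))
                      (A≡tilingsFrom-0-0 (3 + i))) ⟩
  A (6 + i) + A (4 + i) + A (3 + i) ∎
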